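{- Let $G$ be a graph isomorphic to one of $C_5$, the bull, the gem, the co-gem. Let $(A,B)$ be a partition of $V(G)$ into two sets (with $A$ possibly empty) with $|A|<|B|$, and let $H=G\oplus\mathcal{P}$ for some $\mathcal{P}$ with $(A,B)\in\mathcal{P}\subseteq\{(A,A),(B,B),(A,B)\}$. If $H$ has at least two isolated vertices, then either (1) $G$ is the gem, $A$ consists of two non-adjacent vertices of degrees $2$ and $3$, and $\mathcal{P}=\{(B,B),(A,B)\}$; or (2) $G$ is the gem, $A$ consists of the dominating vertex and a vertex of degree $3$, and $\mathcal{P}=\{(A,A),(A,B)\}$. Moreover, in these cases $H$ has exactly two isolated vertices.
   Context: All graphs are finite, simple. For $A,B\subseteq V(G)$, $G\oplus(A,B)$ is the graph on $V(G)$ in which the adjacency of distinct $u,v$ is toggled exactly when $(u,v)\in(A\times B)\cup(B\times A)$; $G\oplus\mathcal{P}$ applies all flips in $\mathcal{P}$. A dominating vertex is adjacent to all other vertices. $C_5$ is the 5-cycle; with $abcd$ an induced path and a fifth vertex $v$: the bull has $v$ adjacent exactly to $b,c$; the gem has $v$ adjacent to all of $a,b,c,d$; the co-gem has $v$ isolated. -}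

module Defs where

open import Data.Bool using (Bool; true; false; not; _∧_; _∨_; if_then_else_)
open import Data.Nat using (ℕ; _<_)
open import Data.Fin using (Fin; zero; suc; _≟_)
open import Data.Fin.Subset using (Subset; ∁; ∣_∣; ⁅_⁆; _∪_)
open import Data.Fin.Permutation using (Permutation; _⟨$⟩ʳ_)
open import Data.Vec using (lookup; tabulate)
open import Data.Product using (Σ; _×_; ∃; ∃-syntax)
open import Relation.Nullary using (¬_; yes; no)
open import Relation.Binary.PropositionalEquality using (_≡_)

record Graph (n : ℕ) : Set where
  field
    adj    : Fin n → Fin n → Bool
    sym    : ∀ u v → adj u v ≡ adj v u
    irrefl : ∀ v → adj v v ≡ false
open Graph public

Adj : ℕ → Set
Adj n = Fin n → Fin n → Bool

_∈ᵇ_ : ∀ {n} → Fin n → Subset n → Bool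
v ∈ᵇ X = lookup X v

flip : ∀ {n} → Subset n → Subset n → Adj n → Adj n
flip X Y a u v with u ≟ v
... | yes _ = a u v
... | no  _ = if ((u ∈ᵇ X) ∧ (v ∈ᵇ Y)) ∨ ((u ∈ᵇ Y) ∧ (v ∈ᵇ X)) then not (a u v) else a u v

data Kind : Set where
  AA BB AB : Kind

-- A set 𝒫 ⊆ {(A,A),(B,B),(A,B)} is a characteristic function on Kind.
FlipSet : Set
FlipSet = Kind → Bool

applyKind : ∀ {n} → Subset n → FlipSet → Kind → Adj n → Adj n
applyKind A 𝒫 AA a = if 𝒫 AA then flip A A a else a
applyKind A 𝒫 BB a = if 𝒫 BB then flip (∁ A) (∁ A) a else a
applyKind A 𝒫 AB a = if 𝒫 AB then flip A (∁ A) a else a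

-- G ⊕ 𝒫 (flips commute, so the order is irrelevant).
_⊕_ : ∀ {n} → Graph n → (Subset n × FlipSet) → Adj n
G ⊕ (A Data.Product., 𝒫) = applyKind A 𝒫 AA (applyKind A 𝒫 BB (applyKind A 𝒫 AB (adj G)))

Isolated : ∀ {n} → Adj n → Fin n → Set
Isolated a u = ∀ v → ¬ (u ≡ v) → a u v ≡ false

degree : ∀ {n} → Graph n → Fin n → ℕ
degree G u = ∣ tabulate (adj G u) ∣

Dominating : ∀ {n} → Graph n → Fin n → Set
Dominating G u = ∀ v → ¬ (u ≡ v) → adj G u v ≡ true

_≅_ : ∀ {n} → Graph n → Graph n → Set
_≅_ {n} G H = Σ (Permutation n n) λ σ → ∀ u v → adj G u v ≡ adj H (σ ⟨$⟩ʳ u) (σ ⟨$⟩ʳ v)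

-- The four specific graphs on Fin 5.  Vertices 0,1,2,3 = induced path a b c d,
-- vertex 4 = v.  (C5: cycle 0-1-2-3-4-0.)

c5adj : Fin 5 → Fin 5 → Bool
c5adj zero (suc zero) = true
c5adj (suc zero) zero = true
c5adj (suc zero) (suc (suc zero)) = true
c5adj (suc (suc zero)) (suc zero) = true
c5adj (suc (suc zero)) (suc (suc (suc zero))) = true
c5adj (suc (suc (suc zero))) (suc (suc zero)) = true
c5adj (suc (suc (suc zero))) (suc (suc (suc (suc zero)))) = true
c5adj (suc (suc (suc (suc zero)))) (suc (suc (suc zero))) = true
c5adj (suc (suc (suc (suc zero)))) zero = true
c5adj zero (suc (suc (suc (suc zero)))) = true
c5adj _ _ = false

pathAdj : Fin 5 → Fin 5 → Bool
pathAdj zero (suc zero) = true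
pathAdj (suc zero) zero = true
pathAdj (suc zero) (suc (suc zero)) = true
pathAdj (suc (suc zero)) (suc zero) = true
pathAdj (suc (suc zero)) (suc (suc (suc zero))) = true
pathAdj (suc (suc (suc zero))) (suc (suc zero)) = true
pathAdj _ _ = false

-- bull: path + vertex 4 adjacent exactly to 1, 2
bullAdj : Fin 5 → Fin 5 → Bool
bullAdj (suc (suc (suc (suc zero)))) (suc zero) = true
bullAdj (suc zero) (suc (suc (suc (suc zero)))) = true
bullAdj (suc (suc (suc (suc zero)))) (suc (suc zero)) = true
bullAdj (suc (suc zero)) (suc (suc (suc (suc zero)))) = true
bullAdj u v = pathAdj u v

-- gem: path + vertex 4 adjacent to all of 0,1,2,3
gemAdj : Fin 5 → Fin 5 → Bool
gemAdj (suc (suc (suc (suc zero)))) (suc (suc (suc (suc zero)))) = false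
gemAdj (suc (suc (suc (suc zero)))) _ = true
gemAdj _ (suc (suc (suc (suc zero)))) = true
gemAdj u v = pathAdj u v

cogemAdj : Fin 5 → Fin 5 → Bool
cogemAdj = pathAdj

open import Relation.Binary.PropositionalEquality using (refl)

all5 : (P : Fin 5 → Set) → P zero → P (suc zero) → P (suc (suc zero))
     → P (suc (suc (suc zero))) → P (suc (suc (suc (suc zero)))) → ∀ v → P v
all5 P p0 p1 p2 p3 p4 zero = p0
all5 P p0 p1 p2 p3 p4 (suc zero) = p1
all5 P p0 p1 p2 p3 p4 (suc (suc zero)) = p2
all5 P p0 p1 p2 p3 p4 (suc (suc (suc zero))) = p3
all5 P p0 p1 p2 p3 p4 (suc (suc (suc (suc zero)))) = p4

row : (a : Fin 5 → Fin 5 → Bool) (u : Fin 5)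
    → a u zero ≡ a zero u → a u (suc zero) ≡ a (suc zero) u
    → a u (suc (suc zero)) ≡ a (suc (suc zero)) u
    → a u (suc (suc (suc zero))) ≡ a (suc (suc (suc zero))) u
    → a u (suc (suc (suc (suc zero)))) ≡ a (suc (suc (suc (suc zero)))) u
    → ∀ v → a u v ≡ a v u
row a u = all5 (λ v → a u v ≡ a v u)

C5 : Graph 5
C5 = record { adj = c5adj
  ; sym = all5 (λ u → ∀ v → c5adj u v ≡ c5adj v u) (row c5adj zero refl refl refl refl refl) (row c5adj (suc zero) refl refl refl refl refl) (row c5adj (suc (suc zero)) refl refl refl refl refl) (row c5adj (suc (suc (suc zero))) refl refl refl refl refl) (row c5adj (suc (suc (suc (suc zero)))) refl refl refl refl refl)
  ; irrefl = all5 (λ v → c5adj v v ≡ false) refl refl refl refl refl }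

Bull : Graph 5
Bull = record { adj = bullAdj
  ; sym = all5 (λ u → ∀ v → bullAdj u v ≡ bullAdj v u) (row bullAdj zero refl refl refl refl refl) (row bullAdj (suc zero) refl refl refl refl refl) (row bullAdj (suc (suc zero)) refl refl refl refl refl) (row bullAdj (suc (suc (suc zero))) refl refl refl refl refl) (row bullAdj (suc (suc (suc (suc zero)))) refl refl refl refl refl)
  ; irrefl = all5 (λ v → bullAdj v v ≡ false) refl refl refl refl refl }

Gem : Graph 5
Gem = record { adj = gemAdj
  ; sym = all5 (λ u → ∀ v → gemAdj u v ≡ gemAdj v u) (row gemAdj zero refl refl refl refl refl) (row gemAdj (suc zero) refl refl refl refl refl) (row gemAdj (suc (suc zero)) refl refl refl refl refl) (row gemAdj (suc (suc (suc zero))) refl refl refl refl refl) (row gemAdj (suc (suc (suc (suc zero)))) refl refl refl refl refl)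
  ; irrefl = all5 (λ v → gemAdj v v ≡ false) refl refl refl refl refl }

CoGem : Graph 5
CoGem = record { adj = cogemAdj
  ; sym = all5 (λ u → ∀ v → cogemAdj u v ≡ cogemAdj v u) (row cogemAdj zero refl refl refl refl refl) (row cogemAdj (suc zero) refl refl refl refl refl) (row cogemAdj (suc (suc zero)) refl refl refl refl refl) (row cogemAdj (suc (suc (suc zero))) refl refl refl refl refl) (row cogemAdj (suc (suc (suc (suc zero)))) refl refl refl refl refl)
  ; irrefl = all5 (λ v → cogemAdj v v ≡ false) refl refl refl refl refl }

{-# OPTIONS --safe #-}
module Submission where

-- Flipping along a partition commutes with relabelling the vertices, and
-- isolation, degrees, domination and the sizes of A and its complement are
-- invariant under relabelling.  So a graph isomorphic to one of the four
-- models behaves like the model itself, transported along the isomorphism,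
-- and for the models the claim is a finite check over the 32 subsets A and
-- the admissible flip sets.

open import Data.Bool as Bool using (Bool; true; false; not; if_then_else_; _∨_)
open import Data.Fin using (Fin; zero; suc; _≟_)
open import Data.Fin.Permutation using (Permutation; _⟨$⟩ʳ_; _⟨$⟩ˡ_; inverseˡ; inverseʳ)
open import Data.Fin.Properties using (all?; any?)
open import Data.Fin.Subset using (Subset; ∁; ∣_∣; ⁅_⁆; _∪_)
open import Data.Fin.Subset.Properties using (anySubset?)
open import Data.Nat as ℕ using (ℕ; _<_)
open import Data.Nat.Properties using (+-0-commutativeMonoid)
open import Data.Product as Product using (_,_; _×_; ∃-syntax; proj₁; proj₂)
open import Data.Sum as Sum using (_⊎_; inj₁; inj₂)
open import Data.Vec using (Vec; lookup; tabulate; map; zipWith)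
open import Data.Vec.Properties
  using (≡-dec; lookup∘tabulate; tabulate∘lookup; tabulate-cong; lookup-map; lookup-zipWith; lookup-replicate)
open import Function using (_∘_; case_of_; _⇔_; mk⇔; Equivalence; Injection)
open import Function.Definitions using (Injective)
open import Function.Properties.Inverse using (↔⇒↣)
open import Relation.Binary.PropositionalEquality
open import Relation.Nullary using (¬_; does; yes; no; contradiction)
open import Relation.Nullary.Decidable
  using (Dec; map′; ¬?; _×-dec_; _⊎-dec_; _→-dec_; does-⇔; decidable-stable; toWitness)

open import Algebra.Properties.CommutativeMonoid.Sum +-0-commutativeMonoid using (sum; sum-permute)
open import Defs hiding (sym)

private variable
  m n : ℕ

lookup-ext : ∀ {A : Set} {xs ys : Vec A n} → (∀ i → lookup xs i ≡ lookup ys i) → xs ≡ ys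
lookup-ext {xs = xs} {ys} eq = begin
  xs                   ≡⟨ tabulate∘lookup xs ⟨
  tabulate (lookup xs) ≡⟨ tabulate-cong eq ⟩
  tabulate (lookup ys) ≡⟨ tabulate∘lookup ys ⟩
  ys                   ∎
  where open ≡-Reasoning

∣tabulate∣≡sum : (p : Fin n → Bool) → ∣ tabulate p ∣ ≡ sum (λ i → if p i then 1 else 0)
∣tabulate∣≡sum {ℕ.zero} p = refl
∣tabulate∣≡sum {ℕ.suc n} p with p zero
... | true  = cong ℕ.suc (∣tabulate∣≡sum (p ∘ suc))
... | false = ∣tabulate∣≡sum (p ∘ suc)

∣tabulate∣-permute : (p : Fin n → Bool) (σ : Permutation m n) →
                     ∣ tabulate (p ∘ (σ ⟨$⟩ʳ_)) ∣ ≡ ∣ tabulate p ∣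
∣tabulate∣-permute p σ = begin
  ∣ tabulate (p ∘ (σ ⟨$⟩ʳ_)) ∣                ≡⟨ ∣tabulate∣≡sum (p ∘ (σ ⟨$⟩ʳ_)) ⟩
  sum (λ i → if p (σ ⟨$⟩ʳ i) then 1 else 0) ≡⟨ sum-permute (λ i → if p i then 1 else 0) σ ⟨
  sum (λ i → if p i then 1 else 0)           ≡⟨ ∣tabulate∣≡sum p ⟨
  ∣ tabulate p ∣                             ∎
  where open ≡-Reasoning

preimage : (Fin m → Fin n) → Subset n → Subset m
preimage f X = tabulate (λ u → f u ∈ᵇ X)

∈ᵇ-preimage : (f : Fin m → Fin n) (X : Subset n) (u : Fin m) → u ∈ᵇ preimage f X ≡ f u ∈ᵇ X
∈ᵇ-preimage f X = lookup∘tabulate (λ u → f u ∈ᵇ X)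

preimage-∁ : (f : Fin m → Fin n) (X : Subset n) → preimage f (∁ X) ≡ ∁ (preimage f X)
preimage-∁ f X = lookup-ext λ u → begin
  u ∈ᵇ preimage f (∁ X)    ≡⟨ ∈ᵇ-preimage f (∁ X) u ⟩
  lookup (map not X) (f u) ≡⟨ lookup-map (f u) not X ⟩
  not (f u ∈ᵇ X)           ≡⟨ cong not (∈ᵇ-preimage f X u) ⟨
  not (u ∈ᵇ preimage f X)  ≡⟨ lookup-map u not (preimage f X) ⟨
  u ∈ᵇ ∁ (preimage f X)    ∎
  where open ≡-Reasoning

preimage-∪ : (f : Fin m → Fin n) (X Y : Subset n) → preimage f (X ∪ Y) ≡ preimage f X ∪ preimage f Y
preimage-∪ f X Y = lookup-ext λ u → begin
  u ∈ᵇ preimage f (X ∪ Y)               ≡⟨ ∈ᵇ-preimage f (X ∪ Y) u ⟩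
  lookup (zipWith _∨_ X Y) (f u)        ≡⟨ lookup-zipWith _∨_ (f u) X Y ⟩
  f u ∈ᵇ X ∨ f u ∈ᵇ Y                   ≡⟨ cong₂ _∨_ (∈ᵇ-preimage f X u) (∈ᵇ-preimage f Y u) ⟨
  u ∈ᵇ preimage f X ∨ u ∈ᵇ preimage f Y ≡⟨ lookup-zipWith _∨_ u (preimage f X) (preimage f Y) ⟨
  u ∈ᵇ (preimage f X ∪ preimage f Y)    ∎
  where open ≡-Reasoning

∈ᵇ-⁅⁆ : (u x : Fin n) → u ∈ᵇ ⁅ x ⁆ ≡ does (u ≟ x)
∈ᵇ-⁅⁆ zero    zero    = refl
∈ᵇ-⁅⁆ (suc u) zero    = lookup-replicate u false
∈ᵇ-⁅⁆ zero    (suc x) = refl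
∈ᵇ-⁅⁆ (suc u) (suc x) = ∈ᵇ-⁅⁆ u x

⟨$⟩ʳ≡⇔≡⟨$⟩ˡ : (σ : Permutation m n) {u : Fin m} {x : Fin n} → σ ⟨$⟩ʳ u ≡ x ⇔ u ≡ σ ⟨$⟩ˡ x
⟨$⟩ʳ≡⇔≡⟨$⟩ˡ σ = mk⇔ (λ { refl → sym (inverseˡ σ) }) (λ { refl → inverseʳ σ })

preimage-⁅⁆ : (σ : Permutation m n) (x : Fin n) → preimage (σ ⟨$⟩ʳ_) ⁅ x ⁆ ≡ ⁅ σ ⟨$⟩ˡ x ⁆
preimage-⁅⁆ σ x = lookup-ext λ u → begin
  u ∈ᵇ preimage (σ ⟨$⟩ʳ_) ⁅ x ⁆  ≡⟨ ∈ᵇ-preimage (σ ⟨$⟩ʳ_) ⁅ x ⁆ u ⟩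
  (σ ⟨$⟩ʳ u) ∈ᵇ ⁅ x ⁆            ≡⟨ ∈ᵇ-⁅⁆ (σ ⟨$⟩ʳ u) x ⟩
  does (σ ⟨$⟩ʳ u ≟ x)            ≡⟨ does-⇔ (⟨$⟩ʳ≡⇔≡⟨$⟩ˡ σ) (σ ⟨$⟩ʳ u ≟ x) (u ≟ σ ⟨$⟩ˡ x) ⟩
  does (u ≟ σ ⟨$⟩ˡ x)            ≡⟨ ∈ᵇ-⁅⁆ u (σ ⟨$⟩ˡ x) ⟨
  u ∈ᵇ ⁅ σ ⟨$⟩ˡ x ⁆              ∎
  where open ≡-Reasoning

image : Permutation m n → Subset m → Subset n
image σ = preimage (σ ⟨$⟩ˡ_)

preimage-image : (σ : Permutation m n) (X : Subset m) → preimage (σ ⟨$⟩ʳ_) (image σ X) ≡ X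
preimage-image σ X = lookup-ext λ u → begin
  u ∈ᵇ preimage (σ ⟨$⟩ʳ_) (image σ X)   ≡⟨ ∈ᵇ-preimage (σ ⟨$⟩ʳ_) (image σ X) u ⟩
  (σ ⟨$⟩ʳ u) ∈ᵇ image σ X               ≡⟨ ∈ᵇ-preimage (σ ⟨$⟩ˡ_) X (σ ⟨$⟩ʳ u) ⟩
  (σ ⟨$⟩ˡ (σ ⟨$⟩ʳ u)) ∈ᵇ X              ≡⟨ cong (_∈ᵇ X) (inverseˡ σ) ⟩
  u ∈ᵇ X                                ∎
  where open ≡-Reasoning

∣preimage∣ : (σ : Permutation m n) (X : Subset n) → ∣ preimage (σ ⟨$⟩ʳ_) X ∣ ≡ ∣ X ∣
∣preimage∣ σ X = trans (∣tabulate∣-permute (lookup X) σ) (cong ∣_∣ (tabulate∘lookup X))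

image-∁ : (σ : Permutation m n) (X : Subset m) → image σ (∁ X) ≡ ∁ (image σ X)
image-∁ σ = preimage-∁ (σ ⟨$⟩ˡ_)

∣image∣ : (σ : Permutation m n) (X : Subset m) → ∣ image σ X ∣ ≡ ∣ X ∣
∣image∣ σ X = trans (sym (∣preimage∣ σ (image σ X))) (cong ∣_∣ (preimage-image σ X))

image≡⁅⁆∪⁅⁆ : (σ : Permutation m n) {X : Subset m} {x y : Fin n} →
              image σ X ≡ ⁅ x ⁆ ∪ ⁅ y ⁆ → X ≡ ⁅ σ ⟨$⟩ˡ x ⁆ ∪ ⁅ σ ⟨$⟩ˡ y ⁆
image≡⁅⁆∪⁅⁆ σ {X} {x} {y} eq = begin
  X                                                   ≡⟨ preimage-image σ X ⟨
  preimage (σ ⟨$⟩ʳ_) (image σ X)                      ≡⟨ cong (preimage (σ ⟨$⟩ʳ_)) eq ⟩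
  preimage (σ ⟨$⟩ʳ_) (⁅ x ⁆ ∪ ⁅ y ⁆)                  ≡⟨ preimage-∪ (σ ⟨$⟩ʳ_) ⁅ x ⁆ ⁅ y ⁆ ⟩
  preimage (σ ⟨$⟩ʳ_) ⁅ x ⁆ ∪ preimage (σ ⟨$⟩ʳ_) ⁅ y ⁆ ≡⟨ cong₂ _∪_ (preimage-⁅⁆ σ x) (preimage-⁅⁆ σ y) ⟩
  ⁅ σ ⟨$⟩ˡ x ⁆ ∪ ⁅ σ ⟨$⟩ˡ y ⁆                         ∎
  where open ≡-Reasoning

⟨$⟩ʳ-injective : (σ : Permutation m n) → Injective _≡_ _≡_ (σ ⟨$⟩ʳ_)
⟨$⟩ʳ-injective σ = Injection.injective (↔⇒↣ σ)

⟨$⟩ˡ-injective : (σ : Permutation m n) → Injective _≡_ _≡_ (σ ⟨$⟩ˡ_)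
⟨$⟩ˡ-injective σ eq = trans (sym (inverseʳ σ)) (trans (cong (σ ⟨$⟩ʳ_) eq) (inverseʳ σ))

relabel : (Fin m → Fin n) → Adj n → Adj m
relabel f a u v = a (f u) (f v)

infix 4 _≗₂_
_≗₂_ : Adj n → Adj n → Set
a ≗₂ b = ∀ u v → a u v ≡ b u v

module _ {f : Fin m → Fin n} (f-injective : Injective _≡_ _≡_ f) where

  flip-relabel : (X Y : Subset n) {a : Adj m} {b : Adj n} → a ≗₂ relabel f b →
                 flip (preimage f X) (preimage f Y) a ≗₂ relabel f (flip X Y b)
  flip-relabel X Y {a} {b} a≗b u v with u ≟ v | f u ≟ f v
  ... | yes _    | yes _     = a≗b u v
  ... | yes refl | no fu≢fu  = contradiction refl fu≢fu
  ... | no u≢v   | yes fu≡fv = contradiction (f-injective fu≡fv) u≢v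
  ... | no _     | no _
    rewrite ∈ᵇ-preimage f X u | ∈ᵇ-preimage f X v | ∈ᵇ-preimage f Y u | ∈ᵇ-preimage f Y v
          | a≗b u v = refl

  applyKind-relabel : (A : Subset n) (𝒫 : FlipSet) (k : Kind) {a : Adj m} {b : Adj n} → a ≗₂ relabel f b →
                      applyKind (preimage f A) 𝒫 k a ≗₂ relabel f (applyKind A 𝒫 k b)
  applyKind-relabel A 𝒫 AA a≗b with 𝒫 AA
  ... | true  = flip-relabel A A a≗b
  ... | false = a≗b
  applyKind-relabel A 𝒫 BB a≗b with 𝒫 BB
  ... | true  rewrite sym (preimage-∁ f A) = flip-relabel (∁ A) (∁ A) a≗b
  ... | false = a≗b
  applyKind-relabel A 𝒫 AB a≗b with 𝒫 AB
  ... | true  rewrite sym (preimage-∁ f A) = flip-relabel A (∁ A) a≗b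
  ... | false = a≗b

  ⊕-relabel : {G : Graph m} {H : Graph n} → adj G ≗₂ relabel f (adj H) → (A : Subset n) (𝒫 : FlipSet) →
              G ⊕ (preimage f A , 𝒫) ≗₂ relabel f (H ⊕ (A , 𝒫))
  ⊕-relabel G≗H A 𝒫 = applyKind-relabel A 𝒫 AA (applyKind-relabel A 𝒫 BB (applyKind-relabel A 𝒫 AB G≗H))

TwoIsolated : Adj n → Set
TwoIsolated h = ∃[ x ] ∃[ y ] (¬ x ≡ y × Isolated h x × Isolated h y)

ExactlyTwoIsolated : Adj n → Set
ExactlyTwoIsolated h = ∃[ x ] ∃[ y ] (¬ x ≡ y × Isolated h x × Isolated h y
                                      × (∀ z → Isolated h z → z ≡ x ⊎ z ≡ y))

module _ (σ : Permutation m n) {a : Adj m} {h : Adj n} (a≗h : a ≗₂ relabel (σ ⟨$⟩ʳ_) h) where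

  Isolated-relabel⁺ : ∀ {x} → Isolated h (σ ⟨$⟩ʳ x) → Isolated a x
  Isolated-relabel⁺ {x} iso v x≢v = trans (a≗h x v) (iso (σ ⟨$⟩ʳ v) (x≢v ∘ ⟨$⟩ʳ-injective σ))

  Isolated-relabel⁻ : ∀ {x} → Isolated a x → Isolated h (σ ⟨$⟩ʳ x)
  Isolated-relabel⁻ {x} iso w σx≢w = begin
    h (σ ⟨$⟩ʳ x) w                   ≡⟨ cong (h _) (inverseʳ σ) ⟨
    h (σ ⟨$⟩ʳ x) (σ ⟨$⟩ʳ (σ ⟨$⟩ˡ w)) ≡⟨ a≗h x (σ ⟨$⟩ˡ w) ⟨
    a x (σ ⟨$⟩ˡ w)                   ≡⟨ iso (σ ⟨$⟩ˡ w) (σx≢w ∘ Equivalence.from (⟨$⟩ʳ≡⇔≡⟨$⟩ˡ σ)) ⟩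
    false                            ∎
    where open ≡-Reasoning

  TwoIsolated-relabel : TwoIsolated a → TwoIsolated h
  TwoIsolated-relabel (x , y , x≢y , iso-x , iso-y) =
    σ ⟨$⟩ʳ x , σ ⟨$⟩ʳ y , x≢y ∘ ⟨$⟩ʳ-injective σ , Isolated-relabel⁻ iso-x , Isolated-relabel⁻ iso-y

  ExactlyTwoIsolated-relabel : ExactlyTwoIsolated h → ExactlyTwoIsolated a
  ExactlyTwoIsolated-relabel (x , y , x≢y , iso-x , iso-y , only) =
    σ ⟨$⟩ˡ x , σ ⟨$⟩ˡ y , x≢y ∘ ⟨$⟩ˡ-injective σ ,
    Isolated-relabel⁺ (subst (Isolated h) (sym (inverseʳ σ)) iso-x) ,
    Isolated-relabel⁺ (subst (Isolated h) (sym (inverseʳ σ)) iso-y) ,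
    λ z iso-z → Sum.map to to (only (σ ⟨$⟩ʳ z) (Isolated-relabel⁻ iso-z))
    where
    to : ∀ {u v} → σ ⟨$⟩ʳ u ≡ v → u ≡ σ ⟨$⟩ˡ v
    to = Equivalence.to (⟨$⟩ʳ≡⇔≡⟨$⟩ˡ σ)

NonAdjacentPair₂₃ : Graph n → Subset n → Set
NonAdjacentPair₂₃ G A = ∃[ x ] ∃[ y ] (A ≡ ⁅ x ⁆ ∪ ⁅ y ⁆ × ¬ x ≡ y × adj G x y ≡ false
                                       × degree G x ≡ 2 × degree G y ≡ 3)

DominatingPair₃ : Graph n → Subset n → Set
DominatingPair₃ G A = ∃[ x ] ∃[ y ] (A ≡ ⁅ x ⁆ ∪ ⁅ y ⁆ × ¬ x ≡ y × Dominating G x × degree G y ≡ 3)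

IsolatesTwo : Graph n → Subset n → FlipSet → Set
IsolatesTwo G A 𝒫 = ∣ A ∣ < ∣ ∁ A ∣ × 𝒫 AB ≡ true × TwoIsolated (G ⊕ (A , 𝒫))

-- The graphs (and the flip data A, 𝒫) are explicit arguments: adj and ∣_∣ are
-- not injective, so they cannot be inferred from the types of the hypotheses.
module _ (G H : Graph n) (G≅H : G ≅ H) where

  private
    σ : Permutation n n
    σ = proj₁ G≅H

    G≗H : adj G ≗₂ relabel (σ ⟨$⟩ʳ_) (adj H)
    G≗H = proj₂ G≅H

  ⊕-≅ : (A : Subset n) (𝒫 : FlipSet) → G ⊕ (A , 𝒫) ≗₂ relabel (σ ⟨$⟩ʳ_) (H ⊕ (image σ A , 𝒫))
  ⊕-≅ A 𝒫 = subst (λ X → G ⊕ (X , 𝒫) ≗₂ relabel (σ ⟨$⟩ʳ_) (H ⊕ (image σ A , 𝒫)))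
                  (preimage-image σ A)
                  (⊕-relabel {f = σ ⟨$⟩ʳ_} (⟨$⟩ʳ-injective σ) {G} {H} G≗H (image σ A) 𝒫)

  adj-≅ : (x y : Fin n) → adj G (σ ⟨$⟩ˡ x) (σ ⟨$⟩ˡ y) ≡ adj H x y
  adj-≅ x y = trans (G≗H (σ ⟨$⟩ˡ x) (σ ⟨$⟩ˡ y)) (cong₂ (adj H) (inverseʳ σ) (inverseʳ σ))

  degree-≅ : (x : Fin n) → degree G (σ ⟨$⟩ˡ x) ≡ degree H x
  degree-≅ x = begin
    ∣ tabulate (adj G (σ ⟨$⟩ˡ x)) ∣                      ≡⟨ cong ∣_∣ (tabulate-cong (G≗H (σ ⟨$⟩ˡ x))) ⟩
    ∣ tabulate (adj H (σ ⟨$⟩ʳ (σ ⟨$⟩ˡ x)) ∘ (σ ⟨$⟩ʳ_)) ∣ ≡⟨ ∣tabulate∣-permute (adj H (σ ⟨$⟩ʳ (σ ⟨$⟩ˡ x))) σ ⟩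
    ∣ tabulate (adj H (σ ⟨$⟩ʳ (σ ⟨$⟩ˡ x))) ∣             ≡⟨ cong (λ y → ∣ tabulate (adj H y) ∣) (inverseʳ σ) ⟩
    ∣ tabulate (adj H x) ∣                               ∎
    where open ≡-Reasoning

  Dominating-≅ : {x : Fin n} → Dominating H x → Dominating G (σ ⟨$⟩ˡ x)
  Dominating-≅ {x} dom v σˡx≢v = begin
    adj G (σ ⟨$⟩ˡ x) v                   ≡⟨ cong (adj G _) (inverseˡ σ) ⟨
    adj G (σ ⟨$⟩ˡ x) (σ ⟨$⟩ˡ (σ ⟨$⟩ʳ v)) ≡⟨ adj-≅ x (σ ⟨$⟩ʳ v) ⟩
    adj H x (σ ⟨$⟩ʳ v)                   ≡⟨ dom (σ ⟨$⟩ʳ v) (σˡx≢v ∘ sym ∘ Equivalence.to (⟨$⟩ʳ≡⇔≡⟨$⟩ˡ σ) ∘ sym) ⟩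
    true                                 ∎
    where open ≡-Reasoning

  NonAdjacentPair₂₃-≅ : {A : Subset n} → NonAdjacentPair₂₃ H (image σ A) → NonAdjacentPair₂₃ G A
  NonAdjacentPair₂₃-≅ (x , y , A≡ , x≢y , x≁y , deg-x , deg-y) =
    σ ⟨$⟩ˡ x , σ ⟨$⟩ˡ y , image≡⁅⁆∪⁅⁆ σ A≡ , x≢y ∘ ⟨$⟩ˡ-injective σ ,
    trans (adj-≅ x y) x≁y , trans (degree-≅ x) deg-x , trans (degree-≅ y) deg-y

  DominatingPair₃-≅ : {A : Subset n} → DominatingPair₃ H (image σ A) → DominatingPair₃ G A
  DominatingPair₃-≅ (x , y , A≡ , x≢y , dom-x , deg-y) =
    σ ⟨$⟩ˡ x , σ ⟨$⟩ˡ y , image≡⁅⁆∪⁅⁆ σ A≡ , x≢y ∘ ⟨$⟩ˡ-injective σ ,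
    Dominating-≅ dom-x , trans (degree-≅ y) deg-y

  IsolatesTwo-≅ : (A : Subset n) (𝒫 : FlipSet) → IsolatesTwo G A 𝒫 → IsolatesTwo H (image σ A) 𝒫
  IsolatesTwo-≅ A 𝒫 (|A|<|∁A| , 𝒫AB , two) =
    subst₂ _<_ (sym (∣image∣ σ A)) (trans (sym (∣image∣ σ (∁ A))) (cong ∣_∣ (image-∁ σ A))) |A|<|∁A| ,
    𝒫AB , TwoIsolated-relabel σ (⊕-≅ A 𝒫) two

GemCases : Graph n → Subset n → FlipSet → Set
GemCases G A 𝒫 = ((NonAdjacentPair₂₃ G A × 𝒫 AA ≡ false × 𝒫 BB ≡ true)
                   ⊎ (DominatingPair₃ G A × 𝒫 AA ≡ true × 𝒫 BB ≡ false))
                 × ExactlyTwoIsolated (G ⊕ (A , 𝒫))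

GemCases-≅ : (G H : Graph n) (G≅H : G ≅ H) (A : Subset n) (𝒫 : FlipSet) →
             GemCases H (image (proj₁ G≅H) A) 𝒫 → GemCases G A 𝒫
GemCases-≅ G H G≅H A 𝒫 (cases , exactly) =
  Sum.map (Product.map₁ (NonAdjacentPair₂₃-≅ G H G≅H)) (Product.map₁ (DominatingPair₃-≅ G H G≅H))
          cases ,
  ExactlyTwoIsolated-relabel (proj₁ G≅H) (⊕-≅ G H G≅H A 𝒫) exactly

Isolated? : (h : Adj n) (x : Fin n) → Dec (Isolated h x)
Isolated? h x = all? λ v → ¬? (x ≟ v) →-dec (h x v Bool.≟ false)

TwoIsolated? : (h : Adj n) → Dec (TwoIsolated h)
TwoIsolated? h = any? λ x → any? λ y → ¬? (x ≟ y) ×-dec Isolated? h x ×-dec Isolated? h y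

ExactlyTwoIsolated? : (h : Adj n) → Dec (ExactlyTwoIsolated h)
ExactlyTwoIsolated? h = any? λ x → any? λ y → ¬? (x ≟ y) ×-dec Isolated? h x ×-dec Isolated? h y
  ×-dec all? λ z → Isolated? h z →-dec (z ≟ x ⊎-dec z ≟ y)

Dominating? : (G : Graph n) (x : Fin n) → Dec (Dominating G x)
Dominating? G x = all? λ v → ¬? (x ≟ v) →-dec (adj G x v Bool.≟ true)

subset-≟ : (X Y : Subset n) → Dec (X ≡ Y)
subset-≟ = ≡-dec Bool._≟_

NonAdjacentPair₂₃? : (G : Graph n) (A : Subset n) → Dec (NonAdjacentPair₂₃ G A)
NonAdjacentPair₂₃? G A = any? λ x → any? λ y → subset-≟ A (⁅ x ⁆ ∪ ⁅ y ⁆) ×-dec ¬? (x ≟ y)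
  ×-dec adj G x y Bool.≟ false ×-dec degree G x ℕ.≟ 2 ×-dec degree G y ℕ.≟ 3

DominatingPair₃? : (G : Graph n) (A : Subset n) → Dec (DominatingPair₃ G A)
DominatingPair₃? G A = any? λ x → any? λ y → subset-≟ A (⁅ x ⁆ ∪ ⁅ y ⁆) ×-dec ¬? (x ≟ y)
  ×-dec Dominating? G x ×-dec degree G y ℕ.≟ 3

IsolatesTwo? : (G : Graph n) (A : Subset n) (𝒫 : FlipSet) → Dec (IsolatesTwo G A 𝒫)
IsolatesTwo? G A 𝒫 = ∣ A ∣ ℕ.<? ∣ ∁ A ∣ ×-dec 𝒫 AB Bool.≟ true ×-dec TwoIsolated? (G ⊕ (A , 𝒫))

GemCases? : (G : Graph n) (A : Subset n) (𝒫 : FlipSet) → Dec (GemCases G A 𝒫)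
GemCases? G A 𝒫 = ((NonAdjacentPair₂₃? G A ×-dec 𝒫 AA Bool.≟ false ×-dec 𝒫 BB Bool.≟ true)
                   ⊎-dec (DominatingPair₃? G A ×-dec 𝒫 AA Bool.≟ true ×-dec 𝒫 BB Bool.≟ false))
                  ×-dec ExactlyTwoIsolated? (G ⊕ (A , 𝒫))

-- IsolatesTwo and GemCases inspect 𝒫 only at the constructors of Kind, so
-- their instances at 𝒫 and at flipSet (𝒫 AA) (𝒫 BB) (𝒫 AB) agree definitionally.
flipSet : Bool → Bool → Bool → FlipSet
flipSet aa bb ab AA = aa
flipSet aa bb ab BB = bb
flipSet aa bb ab AB = ab

∀-Bool? : {P : Bool → Set} → (∀ b → Dec (P b)) → Dec (∀ b → P b)
∀-Bool? P? = map′ (λ (t , f) → λ { true → t ; false → f }) (λ ∀P → ∀P true , ∀P false)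
                  (P? true ×-dec P? false)

∀-Subset? : {P : Subset n → Set} → (∀ X → Dec (P X)) → Dec (∀ X → P X)
∀-Subset? P? with anySubset? (¬? ∘ P?)
... | yes (X , ¬PX) = no λ ∀P → ¬PX (∀P X)
... | no ∄¬P        = yes λ X → decidable-stable (P? X) λ ¬PX → ∄¬P (X , ¬PX)

∀-Flip? : {P : Subset n → FlipSet → Set} → (∀ A 𝒫 → Dec (P A 𝒫)) →
          Dec (∀ A aa bb ab → P A (flipSet aa bb ab))
∀-Flip? P? = ∀-Subset? λ A → ∀-Bool? λ aa → ∀-Bool? λ bb → ∀-Bool? λ ab → P? A (flipSet aa bb ab)

¬IsolatesTwo-C5 : (A : Subset 5) (𝒫 : FlipSet) → ¬ IsolatesTwo C5 A 𝒫
¬IsolatesTwo-C5 A 𝒫 = toWitness {a? = ∀-Flip? λ A 𝒫 → ¬? (IsolatesTwo? C5 A 𝒫)} _ A (𝒫 AA) (𝒫 BB) (𝒫 AB)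

¬IsolatesTwo-Bull : (A : Subset 5) (𝒫 : FlipSet) → ¬ IsolatesTwo Bull A 𝒫
¬IsolatesTwo-Bull A 𝒫 = toWitness {a? = ∀-Flip? λ A 𝒫 → ¬? (IsolatesTwo? Bull A 𝒫)} _ A (𝒫 AA) (𝒫 BB) (𝒫 AB)

¬IsolatesTwo-CoGem : (A : Subset 5) (𝒫 : FlipSet) → ¬ IsolatesTwo CoGem A 𝒫
¬IsolatesTwo-CoGem A 𝒫 = toWitness {a? = ∀-Flip? λ A 𝒫 → ¬? (IsolatesTwo? CoGem A 𝒫)} _ A (𝒫 AA) (𝒫 BB) (𝒫 AB)

IsolatesTwo-Gem : (A : Subset 5) (𝒫 : FlipSet) → IsolatesTwo Gem A 𝒫 → GemCases Gem A 𝒫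
IsolatesTwo-Gem A 𝒫 =
  toWitness {a? = ∀-Flip? λ A 𝒫 → IsolatesTwo? Gem A 𝒫 →-dec GemCases? Gem A 𝒫} _ A (𝒫 AA) (𝒫 BB) (𝒫 AB)

lemma3p3 : (G : Graph 5) → (G ≅ C5 ⊎ G ≅ Bull ⊎ G ≅ Gem ⊎ G ≅ CoGem)
    → (A : Subset 5) → ∣ A ∣ < ∣ ∁ A ∣
    → (𝒫 : FlipSet) → 𝒫 AB ≡ true
    → (∃[ x ] ∃[ y ] (¬ x ≡ y × Isolated (G ⊕ (A , 𝒫)) x × Isolated (G ⊕ (A , 𝒫)) y))
    → ((G ≅ Gem
         × (∃[ x ] ∃[ y ] (A ≡ ⁅ x ⁆ ∪ ⁅ y ⁆ × ¬ x ≡ y × adj G x y ≡ false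
                            × degree G x ≡ 2 × degree G y ≡ 3))
         × 𝒫 AA ≡ false × 𝒫 BB ≡ true)
       ⊎ (G ≅ Gem
         × (∃[ x ] ∃[ y ] (A ≡ ⁅ x ⁆ ∪ ⁅ y ⁆ × ¬ x ≡ y × Dominating G x × degree G y ≡ 3))
         × 𝒫 AA ≡ true × 𝒫 BB ≡ false))
      × (∃[ x ] ∃[ y ] (¬ x ≡ y × Isolated (G ⊕ (A , 𝒫)) x × Isolated (G ⊕ (A , 𝒫)) y
                        × (∀ z → Isolated (G ⊕ (A , 𝒫)) z → z ≡ x ⊎ z ≡ y)))
lemma3p3 G model A |A|<|∁A| 𝒫 𝒫AB two = case model of λ where
    (inj₁ G≅C5)                  → contradiction (IsolatesTwo-≅ G C5 G≅C5 A 𝒫 isolates) (¬IsolatesTwo-C5 _ 𝒫)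
    (inj₂ (inj₁ G≅Bull))         → contradiction (IsolatesTwo-≅ G Bull G≅Bull A 𝒫 isolates) (¬IsolatesTwo-Bull _ 𝒫)
    (inj₂ (inj₂ (inj₂ G≅CoGem))) → contradiction (IsolatesTwo-≅ G CoGem G≅CoGem A 𝒫 isolates) (¬IsolatesTwo-CoGem _ 𝒫)
    (inj₂ (inj₂ (inj₁ G≅Gem)))   →
      let cases , exactly = GemCases-≅ G Gem G≅Gem A 𝒫
                              (IsolatesTwo-Gem _ 𝒫 (IsolatesTwo-≅ G Gem G≅Gem A 𝒫 isolates))
      in Sum.map (G≅Gem ,_) (G≅Gem ,_) cases , exactly
  where
  isolates : IsolatesTwo G A 𝒫
  isolates = |A|<|∁A| , 𝒫AB , two
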